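{- For all integers $n\ge1$ and $0\le r\le n$, $$t\cdot{}^{(r+1)}\!A_n(t)={}^{r}\!A_n(t)+r(t-1)\cdot{}^{r}\!A_{n-1}(t).$$
   Context: $\mathfrak S_n$ is the symmetric group on $[n]=\{1,\dots,n\}$. For $n,r\ge0$, ${}^{r}\!A_n(t)=\sum_{\sigma\in\mathfrak S_n}t^{|\{k\in[n]:\sigma(k)\ge k+r\}|}$ (the number of "$r$-excedances"); in particular ${}^{r}\!A_n(t)=n!$ whenever $r\ge n$. -}

module Defs where

open import Data.Nat using (ℕ; zero; suc; _+_; _≤?_)
open import Data.Fin using (Fin; toℕ)
open import Data.Fin.Properties using (_≟_)
open import Data.List using (List; []; _∷_; [_]; map; concatMap; filter; length; allFin; foldr)
open import Data.Vec using (Vec; lookup; toList) renaming ([] to []ᵥ; _∷_ to _∷ᵥ_)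
open import Data.Integer using (ℤ; _^_) renaming (_+_ to _+ℤ_; +_ to ⁺_)
import Data.List.Relation.Unary.Unique.DecPropositional as UDec

allWords : (n m : ℕ) → List (Vec (Fin m) n)
allWords zero    m = [ []ᵥ ]
allWords (suc n) m = concatMap (λ i → map (i ∷ᵥ_) (allWords n m)) (allFin m)

-- The symmetric group S_n, listed as the injective maps [n] → [n]
-- (one-line notation σ(1)…σ(n), here 0-indexed), each exactly once.
perms : (n : ℕ) → List (Vec (Fin n) n)
perms n = filter (λ σ → UDec.unique? _≟_ (toList σ)) (allWords n n)

-- Number of r-excedances: |{k ∈ [n] : σ(k) ≥ k + r}|.
-- (0-indexing both k and σ(k) shifts both sides by 1, so the condition is unchanged.)
rExc : {n : ℕ} → ℕ → Vec (Fin n) n → ℕ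
rExc {n} r σ = length (filter (λ k → (toℕ k + r) ≤? toℕ (lookup σ k)) (allFin n))

sumℤ : List ℤ → ℤ
sumℤ = foldr _+ℤ_ (⁺ 0)

A : (r n : ℕ) → ℤ → ℤ
A r n t = sumℤ (map (λ σ → t ^ rExc r σ) (perms n))

-- Replace t^e by an arbitrary weight w : ℕ → ℤ and put S_r,n(w) = Σ_{σ ∈ S_n} w(exc_r σ)
-- (excSum r n w).  Every σ ∈ S_{n+1} arises exactly once from some τ ∈ S_n by writing the
-- maximum n at a position j and moving τ(j) to the end.  This changes exc_r by 0 or 1, and for
-- fixed τ exactly (n + 1 - r) - exc_r τ of the n + 1 choices raise it, so S_r,n+1(w) = S_r,n(R w)
-- with R w e = (n+1) w(e) + ((n+1-r) - e) (w(e+1) - w(e)) (insertWeight n r w e).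
-- For r ≤ n this operator turns the shift w ↦ w ∘ suc at r + 1 into the shift at r, and it
-- commutes with the difference operator Δ up to lowering n; induction on n then gives
-- S_r+1,n(w ∘ suc) = S_r,n(w) + r · S_r,n-1(Δ w), which for w = t^· is the theorem.

{-# OPTIONS --safe #-}
module Submission where

open import Defs
import Algebra.Properties.CommutativeMonoid.Sum as CommutativeMonoidSum
open import Data.Fin.Base as Fin using (Fin; toℕ; fromℕ; inject₁; punchIn; lower₁)
open import Data.Fin.Permutation.Components using (transpose; transpose-inverse)
import Data.Fin.Properties as FinP
open import Data.Fin.Relation.Unary.Top using (view; ‵fromℕ; ‵inject₁)
open import Data.Integer.Base using (ℤ; _+_; _*_; _-_; +_; _^_)
import Data.Integer.Properties as ℤP
open import Data.Integer.Tactic.RingSolver using (solve-∀)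
open import Data.List.Base as List
  using (List; []; _∷_; _++_; map; concatMap; cartesianProductWith; allFin; length; filter)
import Data.List.Properties as ListP
open import Data.List.Membership.Propositional using (_∈_)
open import Data.List.Membership.Propositional.Properties
  using (∈-filter⁺; ∈-filter⁻; ∈-allFin; ∈-cartesianProductWith⁺; ∈-cartesianProductWith⁻)
open import Data.List.Membership.Propositional.Properties.WithK using (unique∧set⇒bag)
open import Data.List.Relation.Binary.BagAndSetEquality using (∼bag⇒↭)
open import Data.List.Relation.Binary.Permutation.Propositional using (_↭_; ↭⇒↭ₛ)
import Data.List.Relation.Binary.Permutation.Propositional.Properties as ↭P
import Data.List.Relation.Binary.Permutation.Setoid.Properties as ↭ₛP
import Data.List.Relation.Unary.All as All
import Data.List.Relation.Unary.All.Properties as AllP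
open import Data.List.Relation.Unary.AllPairs using ([]; _∷_)
open import Data.List.Relation.Unary.Any using (here)
open import Data.List.Relation.Unary.Unique.Propositional using (Unique)
import Data.List.Relation.Unary.Unique.Propositional.Properties as UniqueP
import Data.List.Relation.Unary.Unique.DecPropositional as UniqueDec
open import Data.Nat.Base as ℕ using (ℕ; zero; suc; _≤_; _<_; _∸_; _⊓_; z≤n; s≤s)
import Data.Nat.Properties as ℕP
open ℕP using (_≤?_)
import Data.Nat.Tactic.RingSolver as ℕSolver
open import Data.Product.Base using (∃; ∃₂; _×_; _,_; proj₂)
open import Data.Sum.Base using (inj₁; inj₂)
open import Data.Vec.Base as Vec using (Vec; lookup)
open import Data.Vec.Functional using (removeAt)
import Data.Vec.Properties as VecP
open import Function.Base using (_∘_; id)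
open import Function.Bundles using (_⇔_; mk⇔)
open import Function.Definitions using (Injective)
open import Relation.Binary.PropositionalEquality
open import Relation.Nullary using (Dec; yes; no; ¬_; contradiction)
open import Relation.Unary using (Pred; Decidable)

module ℕΣ = CommutativeMonoidSum ℕP.+-0-commutativeMonoid
module ℤΣ = CommutativeMonoidSum ℤP.+-0-commutativeMonoid
open ℕΣ using (sum-syntax)

private variable
  X Y Z : Set
  m n : ℕ

sumBy : (X → ℤ) → List X → ℤ
sumBy f xs = sumℤ (map f xs)

sumℤ-++ : (xs ys : List ℤ) → sumℤ (xs ++ ys) ≡ sumℤ xs + sumℤ ys
sumℤ-++ []       ys = sym (ℤP.+-identityˡ _)
sumℤ-++ (x ∷ xs) ys = trans (cong (_+_ x) (sumℤ-++ xs ys)) (sym (ℤP.+-assoc x _ _))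

sumBy-cong : {f g : X → ℤ} → f ≗ g → (xs : List X) → sumBy f xs ≡ sumBy g xs
sumBy-cong f≗g xs = cong sumℤ (ListP.map-cong f≗g xs)

sumBy-map : (f : Y → ℤ) (g : X → Y) (xs : List X) → sumBy f (map g xs) ≡ sumBy (f ∘ g) xs
sumBy-map f g xs = cong sumℤ (sym (ListP.map-∘ xs))

sumBy-*ˡ : (c : ℤ) (f : X → ℤ) (xs : List X) → sumBy (λ x → c * f x) xs ≡ c * sumBy f xs
sumBy-*ˡ c f []       = sym (ℤP.*-zeroʳ c)
sumBy-*ˡ c f (x ∷ xs) = trans (cong (_+_ (c * f x)) (sumBy-*ˡ c f xs)) (sym (ℤP.*-distribˡ-+ c (f x) _))

sumBy-const : (c : ℤ) (xs : List X) → sumBy (λ _ → c) xs ≡ + length xs * c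
sumBy-const c []       = refl
sumBy-const c (x ∷ xs) = trans (cong (_+_ c) (sumBy-const c xs)) (sym (ℤP.suc-* (+ length xs) c))

sumBy-tabulate : (f : X → ℤ) (g : Fin n → X) → sumBy f (List.tabulate g) ≡ ℤΣ.sum (f ∘ g)
sumBy-tabulate {n = zero}  f g = refl
sumBy-tabulate {n = suc n} f g = cong (_+_ (f (g Fin.zero))) (sumBy-tabulate f (g ∘ Fin.suc))

sumBy-cartesianProductWith : (f : Z → ℤ) (g : X → Y → Z) (xs : List X) (ys : List Y) →
                             sumBy f (cartesianProductWith g xs ys) ≡ sumBy (λ x → sumBy (f ∘ g x) ys) xs
sumBy-cartesianProductWith f g []       ys = refl
sumBy-cartesianProductWith f g (x ∷ xs) ys = begin
  sumℤ (map f (map (g x) ys ++ cartesianProductWith g xs ys))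
    ≡⟨ cong sumℤ (ListP.map-++ f (map (g x) ys) _) ⟩
  sumℤ (map f (map (g x) ys) ++ map f (cartesianProductWith g xs ys))
    ≡⟨ sumℤ-++ (map f (map (g x) ys)) _ ⟩
  sumBy f (map (g x) ys) + sumBy f (cartesianProductWith g xs ys)
    ≡⟨ cong₂ _+_ (sumBy-map f (g x) ys) (sumBy-cartesianProductWith f g xs ys) ⟩
  sumBy (f ∘ g x) ys + sumBy (λ x → sumBy (f ∘ g x) ys) xs ∎
  where open ≡-Reasoning

sumBy-↭ : (f : X → ℤ) {xs ys : List X} → xs ↭ ys → sumBy f xs ≡ sumBy f ys
sumBy-↭ f xs↭ys = ↭ₛP.foldr-commMonoid (setoid ℤ) ℤP.+-0-isCommutativeMonoid (↭⇒↭ₛ (↭P.map⁺ f xs↭ys))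

sumBy-sameElements : (f : X → ℤ) {xs ys : List X} → Unique xs → Unique ys →
                     (∀ {x} → (x ∈ xs) ⇔ (x ∈ ys)) → sumBy f xs ≡ sumBy f ys
sumBy-sameElements f xs! ys! xs≈ys = sumBy-↭ f (∼bag⇒↭ (unique∧set⇒bag xs! ys! xs≈ys))

indicator : {P : Set} → Dec P → ℕ
indicator (yes _) = 1
indicator (no _)  = 0

indicator-≤1 : {P : Set} (p? : Dec P) → indicator p? ≤ 1
indicator-≤1 (yes _) = ℕP.≤-refl
indicator-≤1 (no _)  = z≤n

indicator-mono : {P Q : Set} → (P → Q) → (p? : Dec P) (q? : Dec Q) → indicator p? ≤ indicator q?
indicator-mono P⇒Q (yes p) (no ¬q) = contradiction (P⇒Q p) ¬q
indicator-mono P⇒Q (yes _) (yes _) = ℕP.≤-refl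
indicator-mono P⇒Q (no _)  q?      = z≤n

indicator-no : {P : Set} → ¬ P → (p? : Dec P) → indicator p? ≡ 0
indicator-no ¬p (yes p) = contradiction p ¬p
indicator-no ¬p (no _)  = refl

length-filter-tabulate : {P : Pred X _} (P? : Decidable P) (g : Fin n → X) →
                         length (filter P? (List.tabulate g)) ≡ ∑[ k < n ] indicator (P? (g k))
length-filter-tabulate {n = zero}  P? g = refl
length-filter-tabulate {n = suc n} P? g with P? (g Fin.zero)
... | yes _ = cong suc (length-filter-tabulate P? (g ∘ Fin.suc))
... | no  _ = length-filter-tabulate P? (g ∘ Fin.suc)

sum-exchange : (g h : Fin n → ℕ) (i : Fin n) → (∀ k → k ≢ i → g k ≡ h k) →
               ℕΣ.sum g ℕ.+ h i ≡ ℕΣ.sum h ℕ.+ g i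
sum-exchange {suc n} g h i agree = begin
  ℕΣ.sum g ℕ.+ h i                              ≡⟨ cong (ℕ._+ h i) (ℕΣ.sum-remove g) ⟩
  g i ℕ.+ ℕΣ.sum (removeAt g i) ℕ.+ h i         ≡⟨ cong (λ s → g i ℕ.+ s ℕ.+ h i) (ℕΣ.sum-cong-≗ agree′) ⟩
  g i ℕ.+ ℕΣ.sum (removeAt h i) ℕ.+ h i         ≡⟨ swap-outer (g i) _ (h i) ⟩
  h i ℕ.+ ℕΣ.sum (removeAt h i) ℕ.+ g i         ≡⟨ cong (ℕ._+ g i) (ℕΣ.sum-remove h) ⟨
  ℕΣ.sum h ℕ.+ g i                              ∎
  where
  open ≡-Reasoning
  agree′ : removeAt g i ≗ removeAt h i
  agree′ k = agree (punchIn i k) (FinP.punchInᵢ≢i i k)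
  swap-outer : ∀ a b c → a ℕ.+ b ℕ.+ c ≡ c ℕ.+ b ℕ.+ a
  swap-outer = ℕSolver.solve-∀

excIndicator : ℕ → ℕ → ℕ → ℕ
excIndicator r k v = indicator (k ℕ.+ r ≤? v)

exc : ℕ → (Fin n → Fin n) → ℕ
exc {n} r f = ∑[ k < n ] excIndicator r (toℕ k) (toℕ (f k))

rExc≡exc : (r : ℕ) (σ : Vec (Fin n) n) → rExc r σ ≡ exc r (lookup σ)
rExc≡exc r σ = length-filter-tabulate (λ k → toℕ k ℕ.+ r ≤? toℕ (lookup σ k)) id

exc-cong : (r : ℕ) {f g : Fin n → Fin n} → f ≗ g → exc r f ≡ exc r g
exc-cong r f≗g = ℕΣ.sum-cong-≗ (λ k → cong (excIndicator r (toℕ k) ∘ toℕ) (f≗g k))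

exc-init-last : (r : ℕ) (f : Fin (suc n) → Fin (suc n)) →
                exc r f ≡ ∑[ k < n ] excIndicator r (toℕ k) (toℕ (f (inject₁ k)))
                          ℕ.+ excIndicator r n (toℕ (f (fromℕ n)))
exc-init-last {n} r f = trans (ℕΣ.sum-init-last (λ k → excIndicator r (toℕ k) (toℕ (f k)))) (cong₂ ℕ._+_
  (ℕΣ.sum-cong-≗ (λ k → cong (λ i → excIndicator r i (toℕ (f (inject₁ k)))) (FinP.toℕ-inject₁ k)))
  (cong (λ i → excIndicator r i (toℕ (f (fromℕ n)))) (FinP.toℕ-fromℕ n)))

exc-≥ : (r : ℕ) (f : Fin n → Fin n) → n ≤ r → exc r f ≡ 0
exc-≥ {n} r f n≤r = trans (ℕΣ.sum-cong-≗ none) (ℕΣ.sum-replicate-zero n)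
  where
  none : ∀ k → excIndicator r (toℕ k) (toℕ (f k)) ≡ 0
  none k = indicator-no (ℕP.<⇒≱ (ℕP.<-≤-trans (FinP.toℕ<n (f k)) (ℕP.≤-trans n≤r (ℕP.m≤n+m r (toℕ k))))) _

count-excIndicator : ∀ m r v → ∑[ k < m ] excIndicator r (toℕ k) v ≡ m ⊓ (suc v ∸ r)
count-excIndicator zero    r v = refl
count-excIndicator (suc m) r v = begin
  indicator (r ≤? v) ℕ.+ ∑[ k < m ] excIndicator r (suc (toℕ k)) v
    ≡⟨ cong (indicator (r ≤? v) ℕ.+_) (ℕΣ.sum-cong-≗ {m} (λ k → shift (toℕ k))) ⟩
  indicator (r ≤? v) ℕ.+ ∑[ k < m ] excIndicator (suc r) (toℕ k) v
    ≡⟨ cong (indicator (r ≤? v) ℕ.+_) (count-excIndicator m (suc r) v) ⟩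
  indicator (r ≤? v) ℕ.+ m ⊓ (v ∸ r)
    ≡⟨ add-first r v ⟩
  suc m ⊓ (suc v ∸ r) ∎
  where
  open ≡-Reasoning
  shift : ∀ k → excIndicator r (suc k) v ≡ excIndicator (suc r) k v
  shift k = cong (λ i → indicator (i ≤? v)) (sym (ℕP.+-suc k r))
  add-first : ∀ r v → indicator (r ≤? v) ℕ.+ m ⊓ (v ∸ r) ≡ suc m ⊓ (suc v ∸ r)
  add-first r v with r ≤? v
  ... | yes r≤v = cong (suc m ⊓_) (sym (ℕP.+-∸-assoc 1 r≤v))
  ... | no  r≰v = begin
    m ⊓ (v ∸ r)         ≡⟨ cong (m ⊓_) (ℕP.m≤n⇒m∸n≡0 (ℕP.<⇒≤ (ℕP.≰⇒> r≰v))) ⟩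
    m ⊓ 0               ≡⟨ ℕP.⊓-zeroʳ m ⟩
    suc m ⊓ 0           ≡⟨ cong (suc m ⊓_) (ℕP.m≤n⇒m∸n≡0 (ℕP.≰⇒> r≰v)) ⟨
    suc m ⊓ (suc v ∸ r) ∎

count-excIndicator-upTo : ∀ n r → ∑[ k < n ] excIndicator r (toℕ k) n ℕ.+ excIndicator r n n ≡ suc n ∸ r
count-excIndicator-upTo n r = begin
  ∑[ k < n ] excIndicator r (toℕ k) n ℕ.+ excIndicator r n n
    ≡⟨ cong₂ ℕ._+_ (ℕΣ.sum-cong-≗ {n} (λ k → cong (λ i → excIndicator r i n) (FinP.toℕ-inject₁ k)))
                   (cong (λ i → excIndicator r i n) (FinP.toℕ-fromℕ n)) ⟨
  ∑[ k < n ] excIndicator r (toℕ (inject₁ k)) n ℕ.+ excIndicator r (toℕ (fromℕ n)) n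
    ≡⟨ ℕΣ.sum-init-last {n} (λ k → excIndicator r (toℕ k) n) ⟨
  ∑[ k < suc n ] excIndicator r (toℕ k) n ≡⟨ count-excIndicator (suc n) r n ⟩
  suc n ⊓ (suc n ∸ r)                     ≡⟨ ℕP.m≥n⇒m⊓n≡n (ℕP.m∸n≤m (suc n) r) ⟩
  suc n ∸ r                               ∎
  where open ≡-Reasoning

-- Permutations as injective words

IsPermutation : Vec (Fin n) n → Set
IsPermutation σ = Injective _≡_ _≡_ (lookup σ)

toList≡tabulate∘lookup : (xs : Vec X n) → Vec.toList xs ≡ List.tabulate (lookup xs)
toList≡tabulate∘lookup Vec.[]       = refl
toList≡tabulate∘lookup (x Vec.∷ xs) = cong (x ∷_) (toList≡tabulate∘lookup xs)

unique-tabulate⁻ : {f : Fin n → X} {i j : Fin n} → Unique (List.tabulate f) → f i ≡ f j → i ≡ j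
unique-tabulate⁻ {i = Fin.zero}  {Fin.zero}  _          _  = refl
unique-tabulate⁻ {i = Fin.zero}  {Fin.suc j} (f₀∉ ∷ _)  eq = contradiction eq (AllP.tabulate⁻ f₀∉ j)
unique-tabulate⁻ {i = Fin.suc i} {Fin.zero}  (f₀∉ ∷ _)  eq = contradiction (sym eq) (AllP.tabulate⁻ f₀∉ i)
unique-tabulate⁻ {i = Fin.suc i} {Fin.suc j} (_ ∷ rest) eq = cong Fin.suc (unique-tabulate⁻ rest eq)

concatMap-map≡cartesianProductWith : (f : X → Y → Z) (xs : List X) (ys : List Y) →
  concatMap (λ x → map (f x) ys) xs ≡ cartesianProductWith f xs ys
concatMap-map≡cartesianProductWith f []       ys = refl
concatMap-map≡cartesianProductWith f (x ∷ xs) ys = cong (map (f x) ys ++_) (concatMap-map≡cartesianProductWith f xs ys)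

allWords-unique : ∀ n m → Unique (allWords n m)
allWords-unique zero    m = All.[] ∷ []
allWords-unique (suc n) m = subst Unique (sym (concatMap-map≡cartesianProductWith Vec._∷_ (allFin m) (allWords n m)))
  (UniqueP.cartesianProductWith⁺ Vec._∷_ VecP.∷-injective (UniqueP.allFin⁺ m) (allWords-unique n m))

∈-allWords : (v : Vec (Fin m) n) → v ∈ allWords n m
∈-allWords Vec.[]       = here refl
∈-allWords {m} {suc n} (i Vec.∷ v) =
  subst (i Vec.∷ v ∈_) (sym (concatMap-map≡cartesianProductWith Vec._∷_ (allFin m) (allWords n m)))
  (∈-cartesianProductWith⁺ Vec._∷_ (∈-allFin i) (∈-allWords v))

perms-unique : ∀ n → Unique (perms n)
perms-unique n = UniqueP.filter⁺ _ (allWords-unique n n)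

∈-perms⁺ : {σ : Vec (Fin n) n} → IsPermutation σ → σ ∈ perms n
∈-perms⁺ {σ = σ} σ-inj = ∈-filter⁺ (λ σ → UniqueDec.unique? FinP._≟_ (Vec.toList σ)) (∈-allWords σ)
  (subst Unique (sym (toList≡tabulate∘lookup σ)) (UniqueP.tabulate⁺ σ-inj))

∈-perms⁻ : {σ : Vec (Fin n) n} → σ ∈ perms n → IsPermutation σ
∈-perms⁻ {n} {σ} σ∈ = unique-tabulate⁻ (subst Unique (toList≡tabulate∘lookup σ)
  (proj₂ (∈-filter⁻ (λ σ → UniqueDec.unique? FinP._≟_ (Vec.toList σ)) {xs = allWords n n} σ∈)))

injective⇒surjective : {f : Fin n → Fin n} → Injective _≡_ _≡_ f → ∀ y → ∃ λ x → f x ≡ y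
injective⇒surjective {suc n} {f} f-inj y with FinP.any? (λ x → f x FinP.≟ y)
... | yes hit  = hit
... | no  miss = contradiction (λ {a b} → f-inj ∘ FinP.punchOut-injective (y≢f a) (y≢f b))
                                (FinP.<⇒notInjective (ℕP.n<1+n n))
  where
  y≢f : ∀ x → y ≢ f x
  y≢f x y≡fx = miss (x , sym y≡fx)

transpose-matchˡ : (i j : Fin n) → transpose i j i ≡ j
transpose-matchˡ i j with i FinP.≟ i
... | yes _   = refl
... | no  i≢i = contradiction refl i≢i

transpose-matchʳ : (i j : Fin n) → transpose i j j ≡ i
transpose-matchʳ i j with j FinP.≟ i
... | yes j≡i = j≡i
... | no  _ with j FinP.≟ j
...   | yes _   = refl
...   | no  j≢j = contradiction refl j≢j

transpose-fixes : {i j k : Fin n} → k ≢ i → k ≢ j → transpose i j k ≡ k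
transpose-fixes {i = i} {j} {k} k≢i k≢j with k FinP.≟ i
... | yes k≡i = contradiction k≡i k≢i
... | no  _ with k FinP.≟ j
...   | yes k≡j = contradiction k≡j k≢j
...   | no  _   = refl

transpose-diag : (i k : Fin n) → transpose i i k ≡ k
transpose-diag i k with k FinP.≟ i
... | yes k≡i = sym k≡i
... | no  _ with k FinP.≟ i
...   | yes k≡i = sym k≡i
...   | no  _   = refl

transpose-injective : (i j : Fin n) → Injective _≡_ _≡_ (transpose i j)
transpose-injective i j {a} {b} eq = begin
  a                               ≡⟨ transpose-inverse j i ⟨
  transpose j i (transpose i j a) ≡⟨ cong (transpose j i) eq ⟩
  transpose j i (transpose i j b) ≡⟨ transpose-inverse j i ⟩
  b                               ∎
  where open ≡-Reasoning

-- Inserting the maximum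

≗-lookup⇒≡ : {u v : Vec X n} → lookup u ≗ lookup v → u ≡ v
≗-lookup⇒≡ {u = u} {v} eq = begin
  u                       ≡⟨ VecP.tabulate∘lookup u ⟨
  Vec.tabulate (lookup u) ≡⟨ VecP.tabulate-cong eq ⟩
  Vec.tabulate (lookup v) ≡⟨ VecP.tabulate∘lookup v ⟩
  v                       ∎
  where open ≡-Reasoning

lookup-∷ʳ-inject₁ : (xs : Vec X n) (x : X) (k : Fin n) → lookup (xs Vec.∷ʳ x) (inject₁ k) ≡ lookup xs k
lookup-∷ʳ-inject₁ (y Vec.∷ xs) x Fin.zero    = refl
lookup-∷ʳ-inject₁ (y Vec.∷ xs) x (Fin.suc k) = lookup-∷ʳ-inject₁ xs x k

lookup-∷ʳ-fromℕ : (xs : Vec X n) (x : X) → lookup (xs Vec.∷ʳ x) (fromℕ n) ≡ x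
lookup-∷ʳ-fromℕ Vec.[]       x = refl
lookup-∷ʳ-fromℕ (y Vec.∷ xs) x = lookup-∷ʳ-fromℕ xs x

extend : Vec (Fin n) n → Vec (Fin (suc n)) (suc n)
extend {n} τ = Vec.map inject₁ τ Vec.∷ʳ fromℕ n

lookup-extend-inject₁ : (τ : Vec (Fin n) n) (k : Fin n) → lookup (extend τ) (inject₁ k) ≡ inject₁ (lookup τ k)
lookup-extend-inject₁ {n} τ k =
  trans (lookup-∷ʳ-inject₁ (Vec.map inject₁ τ) (fromℕ n) k) (VecP.lookup-map k inject₁ τ)

lookup-extend-fromℕ : (τ : Vec (Fin n) n) → lookup (extend τ) (fromℕ n) ≡ fromℕ n
lookup-extend-fromℕ {n} τ = lookup-∷ʳ-fromℕ (Vec.map inject₁ τ) (fromℕ n)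

lookup-extend≡fromℕ⇒≡fromℕ : (τ : Vec (Fin n) n) {k : Fin (suc n)} →
                             lookup (extend τ) k ≡ fromℕ n → k ≡ fromℕ n
lookup-extend≡fromℕ⇒≡fromℕ τ {k} eq with view k
... | ‵fromℕ     = refl
... | ‵inject₁ k = contradiction (trans (sym eq) (lookup-extend-inject₁ τ k)) FinP.fromℕ≢inject₁

extend-isPermutation : {τ : Vec (Fin n) n} → IsPermutation τ → IsPermutation (extend τ)
extend-isPermutation {n} {τ} τ-inj {a} {b} eq with view a | view b
... | ‵fromℕ     | ‵fromℕ     = refl
... | ‵fromℕ     | ‵inject₁ b = sym (lookup-extend≡fromℕ⇒≡fromℕ τ (trans (sym eq) (lookup-extend-fromℕ τ)))
... | ‵inject₁ a | ‵fromℕ     = lookup-extend≡fromℕ⇒≡fromℕ τ (trans eq (lookup-extend-fromℕ τ))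
... | ‵inject₁ a | ‵inject₁ b = cong inject₁ (τ-inj (FinP.inject₁-injective
  (trans (sym (lookup-extend-inject₁ τ a)) (trans eq (lookup-extend-inject₁ τ b)))))

extend-surjective : (ρ : Fin (suc n) → Fin (suc n)) → Injective _≡_ _≡_ ρ → ρ (fromℕ n) ≡ fromℕ n →
                    ∃ λ τ → IsPermutation τ × lookup (extend τ) ≗ ρ
extend-surjective {n} ρ ρ-inj ρ-top = τ , τ-inj , extend-τ
  where
  n≢ρ : ∀ k → n ≢ toℕ (ρ (inject₁ k))
  n≢ρ k eq = FinP.fromℕ≢inject₁ (ρ-inj (trans ρ-top (sym (FinP.toℕ-injective
    (trans (sym eq) (sym (FinP.toℕ-fromℕ n)))))))
  τ : Vec (Fin n) n
  τ = Vec.tabulate (λ k → lower₁ (ρ (inject₁ k)) (n≢ρ k))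
  extend-τ : lookup (extend τ) ≗ ρ
  extend-τ k with view k
  ... | ‵fromℕ     = trans (lookup-extend-fromℕ τ) (sym ρ-top)
  ... | ‵inject₁ k = begin
    lookup (extend τ) (inject₁ k)            ≡⟨ lookup-extend-inject₁ τ k ⟩
    inject₁ (lookup τ k)                     ≡⟨ cong inject₁ (VecP.lookup∘tabulate _ k) ⟩
    inject₁ (lower₁ (ρ (inject₁ k)) (n≢ρ k)) ≡⟨ FinP.inject₁-lower₁ _ (n≢ρ k) ⟩
    ρ (inject₁ k)                            ∎
    where open ≡-Reasoning
  τ-inj : IsPermutation τ
  τ-inj {a} {b} eq = FinP.inject₁-injective (ρ-inj (begin
    ρ (inject₁ a)                 ≡⟨ extend-τ (inject₁ a) ⟨
    lookup (extend τ) (inject₁ a) ≡⟨ lookup-extend-inject₁ τ a ⟩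
    inject₁ (lookup τ a)          ≡⟨ cong inject₁ eq ⟩
    inject₁ (lookup τ b)          ≡⟨ lookup-extend-inject₁ τ b ⟨
    lookup (extend τ) (inject₁ b) ≡⟨ extend-τ (inject₁ b) ⟩
    ρ (inject₁ b)                 ∎))
    where open ≡-Reasoning

-- τ extended by the fixed point n, composed with the transposition (j n): in one-line notation,
-- n is written at position j and τ(j) is moved to the end.
insertMax : Vec (Fin n) n → Fin (suc n) → Vec (Fin (suc n)) (suc n)
insertMax {n} τ j = Vec.tabulate (lookup (extend τ) ∘ transpose j (fromℕ n))

lookup-insertMax : (τ : Vec (Fin n) n) (j k : Fin (suc n)) →
                   lookup (insertMax τ j) k ≡ lookup (extend τ) (transpose j (fromℕ n) k)
lookup-insertMax τ j = VecP.lookup∘tabulate _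

lookup-insertMax-self : (τ : Vec (Fin n) n) (j : Fin (suc n)) → lookup (insertMax τ j) j ≡ fromℕ n
lookup-insertMax-self {n} τ j = trans (lookup-insertMax τ j j)
  (trans (cong (lookup (extend τ)) (transpose-matchˡ j (fromℕ n))) (lookup-extend-fromℕ τ))

insertMax-isPermutation : {τ : Vec (Fin n) n} → IsPermutation τ → (j : Fin (suc n)) → IsPermutation (insertMax τ j)
insertMax-isPermutation {n} {τ} τ-inj j {a} {b} eq = transpose-injective j (fromℕ n)
  (extend-isPermutation {τ = τ} τ-inj (trans (sym (lookup-insertMax τ j a)) (trans eq (lookup-insertMax τ j b))))

insertMax-position-injective : {τ τ′ : Vec (Fin n) n} {j j′ : Fin (suc n)} →
                               insertMax τ j ≡ insertMax τ′ j′ → j ≡ j′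
insertMax-position-injective {n} {τ} {τ′} {j} {j′} eq = transpose-injective j′ (fromℕ n) (begin
  transpose j′ (fromℕ n) j  ≡⟨ lookup-extend≡fromℕ⇒≡fromℕ τ′ top-at-j ⟩
  fromℕ n                   ≡⟨ transpose-matchˡ j′ (fromℕ n) ⟨
  transpose j′ (fromℕ n) j′ ∎)
  where
  open ≡-Reasoning
  top-at-j : lookup (extend τ′) (transpose j′ (fromℕ n) j) ≡ fromℕ n
  top-at-j = begin
    lookup (extend τ′) (transpose j′ (fromℕ n) j) ≡⟨ lookup-insertMax τ′ j′ j ⟨
    lookup (insertMax τ′ j′) j                    ≡⟨ cong (λ σ → lookup σ j) eq ⟨
    lookup (insertMax τ j) j                      ≡⟨ lookup-insertMax-self τ j ⟩
    fromℕ n                                       ∎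

insertMax-injective : {τ τ′ : Vec (Fin n) n} {j j′ : Fin (suc n)} →
                      insertMax τ j ≡ insertMax τ′ j′ → τ ≡ τ′ × j ≡ j′
insertMax-injective {n} {τ} {τ′} {j} {j′} eq with refl ← insertMax-position-injective {τ = τ} {τ′} {j} {j′} eq =
  ≗-lookup⇒≡ τ≗τ′ , refl
  where
  open ≡-Reasoning
  extend-τ≗τ′ : lookup (extend τ) ≗ lookup (extend τ′)
  extend-τ≗τ′ k = begin
    lookup (extend τ) k                        ≡⟨ cong (lookup (extend τ)) (transpose-inverse j (fromℕ n)) ⟨
    lookup (extend τ) (transpose j (fromℕ n) k′)  ≡⟨ lookup-insertMax τ j k′ ⟨
    lookup (insertMax τ j) k′                  ≡⟨ cong (λ σ → lookup σ k′) eq ⟩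
    lookup (insertMax τ′ j) k′                 ≡⟨ lookup-insertMax τ′ j k′ ⟩
    lookup (extend τ′) (transpose j (fromℕ n) k′) ≡⟨ cong (lookup (extend τ′)) (transpose-inverse j (fromℕ n)) ⟩
    lookup (extend τ′) k                       ∎
    where k′ = transpose (fromℕ n) j k
  τ≗τ′ : lookup τ ≗ lookup τ′
  τ≗τ′ k = FinP.inject₁-injective (begin
    inject₁ (lookup τ k)           ≡⟨ lookup-extend-inject₁ τ k ⟨
    lookup (extend τ) (inject₁ k)  ≡⟨ extend-τ≗τ′ (inject₁ k) ⟩
    lookup (extend τ′) (inject₁ k) ≡⟨ lookup-extend-inject₁ τ′ k ⟩
    inject₁ (lookup τ′ k)          ∎)

insertMax-surjective : {σ : Vec (Fin (suc n)) (suc n)} → IsPermutation σ →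
                       ∃₂ λ τ j → IsPermutation τ × insertMax τ j ≡ σ
insertMax-surjective {n} {σ} σ-inj
  with j , σj≡top ← injective⇒surjective σ-inj (fromℕ n)
  with τ , τ-inj , extend-τ≗ρ ← extend-surjective (lookup σ ∘ transpose (fromℕ n) j)
         (transpose-injective (fromℕ n) j ∘ σ-inj) (trans (cong (lookup σ) (transpose-matchˡ (fromℕ n) j)) σj≡top)
  = τ , j , τ-inj , ≗-lookup⇒≡ λ k → begin
    lookup (insertMax τ j) k                                   ≡⟨ lookup-insertMax τ j k ⟩
    lookup (extend τ) (transpose j (fromℕ n) k)                ≡⟨ extend-τ≗ρ _ ⟩
    lookup σ (transpose (fromℕ n) j (transpose j (fromℕ n) k)) ≡⟨ cong (lookup σ) (transpose-inverse (fromℕ n) j) ⟩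
    lookup σ k                                                 ∎
  where open ≡-Reasoning

∈-perms-suc⇔ : {σ : Vec (Fin (suc n)) (suc n)} →
               (σ ∈ perms (suc n)) ⇔ (σ ∈ cartesianProductWith insertMax (perms n) (allFin (suc n)))
∈-perms-suc⇔ {n} = mk⇔ to from
  where
  to : ∀ {σ} → σ ∈ perms (suc n) → σ ∈ cartesianProductWith insertMax (perms n) (allFin (suc n))
  to σ∈ with insertMax-surjective (∈-perms⁻ σ∈)
  ... | τ , j , τ-inj , insert≡σ =
    subst (_∈ cartesianProductWith insertMax (perms n) (allFin (suc n))) insert≡σ
      (∈-cartesianProductWith⁺ insertMax (∈-perms⁺ {σ = τ} τ-inj) (∈-allFin j))
  from : ∀ {σ} → σ ∈ cartesianProductWith insertMax (perms n) (allFin (suc n)) → σ ∈ perms (suc n)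
  from σ∈ with ∈-cartesianProductWith⁻ insertMax (perms n) (allFin (suc n)) σ∈
  ... | τ , j , τ∈ , _ , refl = ∈-perms⁺ {σ = insertMax τ j} (insertMax-isPermutation {τ = τ} (∈-perms⁻ τ∈) j)

exc-extend : (r : ℕ) (τ : Vec (Fin n) n) → exc r (lookup (extend τ)) ≡ exc r (lookup τ) ℕ.+ excIndicator r n n
exc-extend {n} r τ = trans (exc-init-last r (lookup (extend τ))) (cong₂ ℕ._+_
  (ℕΣ.sum-cong-≗ (λ k → cong (excIndicator r (toℕ k))
    (trans (cong toℕ (lookup-extend-inject₁ τ k)) (FinP.toℕ-inject₁ _))))
  (cong (excIndicator r n) (trans (cong toℕ (lookup-extend-fromℕ τ)) (FinP.toℕ-fromℕ n))))

exc-insertMax-fromℕ : (r : ℕ) (τ : Vec (Fin n) n) →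
                      exc r (lookup (insertMax τ (fromℕ n))) ≡ exc r (lookup τ) ℕ.+ excIndicator r n n
exc-insertMax-fromℕ {n} r τ = trans
  (exc-cong r (λ k → trans (lookup-insertMax τ (fromℕ n) k) (cong (lookup (extend τ)) (transpose-diag (fromℕ n) k))))
  (exc-extend r τ)

exc-insertMax-inject₁ : (r : ℕ) (τ : Vec (Fin n) n) (j : Fin n) →
  exc r (lookup (insertMax τ (inject₁ j))) ℕ.+ excIndicator r (toℕ j) (toℕ (lookup τ j))
    ≡ exc r (lookup τ) ℕ.+ excIndicator r (toℕ j) n
exc-insertMax-inject₁ {n} r τ j = begin
  exc r σ ℕ.+ h j                                            ≡⟨ cong (ℕ._+ h j) (exc-init-last r σ) ⟩
  ℕΣ.sum g ℕ.+ excIndicator r n (toℕ (σ (fromℕ n))) ℕ.+ h j ≡⟨ cong (λ x → ℕΣ.sum g ℕ.+ x ℕ.+ h j) top-not-exc ⟩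
  ℕΣ.sum g ℕ.+ 0 ℕ.+ h j                                     ≡⟨ cong (ℕ._+ h j) (ℕP.+-identityʳ _) ⟩
  ℕΣ.sum g ℕ.+ h j                                           ≡⟨ sum-exchange g h j g≡h ⟩
  ℕΣ.sum h ℕ.+ g j                                           ≡⟨ cong (exc r (lookup τ) ℕ.+_) g-at-j ⟩
  exc r (lookup τ) ℕ.+ excIndicator r (toℕ j) n              ∎
  where
  open ≡-Reasoning
  σ = lookup (insertMax τ (inject₁ j))
  g h : Fin n → ℕ
  g k = excIndicator r (toℕ k) (toℕ (σ (inject₁ k)))
  h k = excIndicator r (toℕ k) (toℕ (lookup τ k))
  σ-top : σ (fromℕ n) ≡ inject₁ (lookup τ j)
  σ-top = trans (lookup-insertMax τ (inject₁ j) (fromℕ n))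
    (trans (cong (lookup (extend τ)) (transpose-matchʳ (inject₁ j) (fromℕ n))) (lookup-extend-inject₁ τ j))
  top-not-exc : excIndicator r n (toℕ (σ (fromℕ n))) ≡ 0
  top-not-exc = indicator-no (ℕP.<⇒≱ (ℕP.<-≤-trans σ-top<n (ℕP.m≤m+n n r))) _
    where
    σ-top<n : toℕ (σ (fromℕ n)) < n
    σ-top<n = subst (_< n) (sym (trans (cong toℕ σ-top) (FinP.toℕ-inject₁ _))) (FinP.toℕ<n _)
  g≡h : ∀ k → k ≢ j → g k ≡ h k
  g≡h k k≢j = cong (excIndicator r (toℕ k)) (begin
    toℕ (σ (inject₁ k))
      ≡⟨ cong toℕ (lookup-insertMax τ (inject₁ j) (inject₁ k)) ⟩
    toℕ (lookup (extend τ) (transpose (inject₁ j) (fromℕ n) (inject₁ k)))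
      ≡⟨ cong (toℕ ∘ lookup (extend τ))
              (transpose-fixes (k≢j ∘ FinP.inject₁-injective) (FinP.fromℕ≢inject₁ ∘ sym)) ⟩
    toℕ (lookup (extend τ) (inject₁ k)) ≡⟨ cong toℕ (lookup-extend-inject₁ τ k) ⟩
    toℕ (inject₁ (lookup τ k))          ≡⟨ FinP.toℕ-inject₁ _ ⟩
    toℕ (lookup τ k)                    ∎)
  g-at-j : g j ≡ excIndicator r (toℕ j) n
  g-at-j = cong (excIndicator r (toℕ j)) (trans (cong toℕ (lookup-insertMax-self τ (inject₁ j))) (FinP.toℕ-fromℕ n))

-- Weighted excedance sums

Δ : (ℕ → ℤ) → ℕ → ℤ
Δ w e = w (suc e) - w e

weight-step : (w : ℕ → ℤ) {e e′ a b : ℕ} → e′ ℕ.+ a ≡ e ℕ.+ b → a ≤ b → b ≤ 1 →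
              w e′ ≡ w e + (+ b - + a) * Δ w e
weight-step w {e} {e′} eq z≤n z≤n = trans (cong w e′≡e) (no-step (w e) (w (suc e)))
  where
  e′≡e : e′ ≡ e
  e′≡e = trans (sym (ℕP.+-identityʳ e′)) (trans eq (ℕP.+-identityʳ e))
  no-step : ∀ x y → x ≡ x + (+ 0 - + 0) * (y - x)
  no-step = solve-∀
weight-step w {e} {e′} eq z≤n (s≤s z≤n) = trans (cong w e′≡1+e) (one-step (w e) (w (suc e)))
  where
  e′≡1+e : e′ ≡ suc e
  e′≡1+e = trans (sym (ℕP.+-identityʳ e′)) (trans eq (ℕP.+-comm e 1))
  one-step : ∀ x y → y ≡ x + (+ 1 - + 0) * (y - x)
  one-step = solve-∀
weight-step w {e} {e′} eq (s≤s z≤n) (s≤s z≤n) =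
  trans (cong w (ℕP.+-cancelʳ-≡ 1 e′ e eq)) (no-step (w e) (w (suc e)))
  where
  no-step : ∀ x y → x ≡ x + (+ 1 - + 1) * (y - x)
  no-step = solve-∀

sum-affine : (c d : ℤ) (a b : Fin n → ℕ) →
             ℤΣ.sum (λ j → c + (+ b j - + a j) * d) ≡ + n * c + (+ ℕΣ.sum b - + ℕΣ.sum a) * d
sum-affine {zero}  c d a b = empty c d
  where
  empty : ∀ c d → + 0 ≡ + 0 * c + (+ 0 - + 0) * d
  empty = solve-∀
sum-affine {suc n} c d a b = begin
  c + (+ b₀ - + a₀) * d + ℤΣ.sum (λ j → c + (+ b (Fin.suc j) - + a (Fin.suc j)) * d)
    ≡⟨ cong (_+_ (c + (+ b₀ - + a₀) * d)) (sum-affine c d (a ∘ Fin.suc) (b ∘ Fin.suc)) ⟩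
  c + (+ b₀ - + a₀) * d + (+ n * c + (+ ℕΣ.sum (b ∘ Fin.suc) - + ℕΣ.sum (a ∘ Fin.suc)) * d)
    ≡⟨ collect c d (+ n) (+ b₀) (+ a₀) (+ ℕΣ.sum (b ∘ Fin.suc)) (+ ℕΣ.sum (a ∘ Fin.suc)) ⟩
  + suc n * c + (+ ℕΣ.sum b - + ℕΣ.sum a) * d ∎
  where
  open ≡-Reasoning
  a₀ = a Fin.zero
  b₀ = b Fin.zero
  collect : ∀ c d n b₀ a₀ B A →
            c + (b₀ - a₀) * d + (n * c + (B - A) * d) ≡ (+ 1 + n) * c + ((b₀ + B) - (a₀ + A)) * d
  collect = solve-∀

insertWeight : ℕ → ℕ → (ℕ → ℤ) → ℕ → ℤ
insertWeight n r w e = + suc n * w e + (+ (suc n ∸ r) - + e) * Δ w e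

sum-insertMax : (r : ℕ) (w : ℕ → ℤ) (τ : Vec (Fin n) n) →
                sumBy (w ∘ rExc r ∘ insertMax τ) (allFin (suc n)) ≡ insertWeight n r w (rExc r τ)
sum-insertMax {n} r w τ = begin
  sumBy (w ∘ rExc r ∘ insertMax τ) (allFin (suc n))
    ≡⟨ sumBy-tabulate (w ∘ rExc r ∘ insertMax τ) id ⟩
  ℤΣ.sum (w ∘ rExc r ∘ insertMax τ)
    ≡⟨ ℤΣ.sum-cong-≗ (λ j → cong w (rExc≡exc r (insertMax τ j))) ⟩
  ℤΣ.sum (λ j → w (exc r (lookup (insertMax τ j))))
    ≡⟨ ℤΣ.sum-init-last (λ j → w (exc r (lookup (insertMax τ j)))) ⟩
  ℤΣ.sum (λ j → w (exc r (lookup (insertMax τ (inject₁ j))))) + w (exc r (lookup (insertMax τ (fromℕ n))))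
    ≡⟨ cong₂ _+_ (ℤΣ.sum-cong-≗ step-inject₁) step-fromℕ ⟩
  ℤΣ.sum (λ j → w e + (+ b j - + a j) * Δ w e) + (w e + (+ c - + 0) * Δ w e)
    ≡⟨ cong (_+ (w e + (+ c - + 0) * Δ w e)) (sum-affine (w e) (Δ w e) a b) ⟩
  + n * w e + (+ ℕΣ.sum b - + e) * Δ w e + (w e + (+ c - + 0) * Δ w e)
    ≡⟨ collect (w e) (Δ w e) (+ n) (+ ℕΣ.sum b) (+ c) (+ e) ⟩
  + suc n * w e + (+ (ℕΣ.sum b ℕ.+ c) - + e) * Δ w e
    ≡⟨ cong (λ m → + suc n * w e + (+ m - + e) * Δ w e) (count-excIndicator-upTo n r) ⟩
  insertWeight n r w e
    ≡⟨ cong (insertWeight n r w) (rExc≡exc r τ) ⟨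
  insertWeight n r w (rExc r τ) ∎
  where
  open ≡-Reasoning
  e = exc r (lookup τ)
  a b : Fin n → ℕ
  a j = excIndicator r (toℕ j) (toℕ (lookup τ j))
  b j = excIndicator r (toℕ j) n
  c = excIndicator r n n
  step-inject₁ : ∀ j → w (exc r (lookup (insertMax τ (inject₁ j)))) ≡ w e + (+ b j - + a j) * Δ w e
  step-inject₁ j = weight-step w (exc-insertMax-inject₁ r τ j)
    (indicator-mono (λ le → ℕP.≤-trans le (ℕP.<⇒≤ (FinP.toℕ<n (lookup τ j)))) _ _) (indicator-≤1 _)
  step-fromℕ : w (exc r (lookup (insertMax τ (fromℕ n)))) ≡ w e + (+ c - + 0) * Δ w e
  step-fromℕ = weight-step w (trans (ℕP.+-identityʳ _) (exc-insertMax-fromℕ r τ)) z≤n (indicator-≤1 _)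
  collect : ∀ x d n B c e → n * x + (B - e) * d + (x + (c - + 0) * d) ≡ (+ 1 + n) * x + ((B + c) - e) * d
  collect = solve-∀

excSum : ℕ → ℕ → (ℕ → ℤ) → ℤ
excSum r n w = sumBy (w ∘ rExc r) (perms n)

excSum-suc : (r n : ℕ) (w : ℕ → ℤ) → excSum r (suc n) w ≡ excSum r n (insertWeight n r w)
excSum-suc r n w = begin
  sumBy f (perms (suc n))
    ≡⟨ sumBy-sameElements f (perms-unique (suc n)) insertions-unique ∈-perms-suc⇔ ⟩
  sumBy f (cartesianProductWith insertMax (perms n) (allFin (suc n)))
    ≡⟨ sumBy-cartesianProductWith f insertMax (perms n) (allFin (suc n)) ⟩
  sumBy (λ τ → sumBy (f ∘ insertMax τ) (allFin (suc n))) (perms n)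
    ≡⟨ sumBy-cong (sum-insertMax r w) (perms n) ⟩
  excSum r n (insertWeight n r w) ∎
  where
  open ≡-Reasoning
  f = w ∘ rExc r
  insertions-unique = UniqueP.cartesianProductWith⁺ insertMax insertMax-injective (perms-unique n) (UniqueP.allFin⁺ (suc n))

excSum-cong : (r n : ℕ) {w w′ : ℕ → ℤ} → w ≗ w′ → excSum r n w ≡ excSum r n w′
excSum-cong r n w≗w′ = sumBy-cong (w≗w′ ∘ rExc r) (perms n)

excSum-*ˡ : (r n : ℕ) (c : ℤ) (w : ℕ → ℤ) → excSum r n (λ e → c * w e) ≡ c * excSum r n w
excSum-*ˡ r n c w = sumBy-*ˡ c (w ∘ rExc r) (perms n)

excSum-≥ : (r n : ℕ) (w : ℕ → ℤ) → n ≤ r → excSum r n w ≡ + length (perms n) * w 0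
excSum-≥ r n w n≤r = trans
  (sumBy-cong (λ σ → cong w (trans (rExc≡exc r σ) (exc-≥ r (lookup σ) n≤r))) (perms n))
  (sumBy-const (w 0) (perms n))

insertWeight-≥ : (n r : ℕ) (w : ℕ → ℤ) → suc n ≤ r → insertWeight n r w 0 ≡ + suc n * w 0
insertWeight-≥ n r w 1+n≤r = begin
  + suc n * w 0 + (+ (suc n ∸ r) - + 0) * Δ w 0
    ≡⟨ cong (λ m → + suc n * w 0 + (+ m - + 0) * Δ w 0) (ℕP.m≤n⇒m∸n≡0 1+n≤r) ⟩
  + suc n * w 0 + (+ 0 - + 0) * Δ w 0
    ≡⟨ no-change (+ suc n * w 0) (Δ w 0) ⟩
  + suc n * w 0 ∎
  where
  open ≡-Reasoning
  no-change : ∀ x d → x + (+ 0 - + 0) * d ≡ x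
  no-change = solve-∀

insertWeight-shift : (n r : ℕ) (w : ℕ → ℤ) → r ≤ n →
                     insertWeight n (suc r) (w ∘ suc) ≗ insertWeight n r w ∘ suc
insertWeight-shift n r w r≤n e = cong (λ x → + suc n * w (suc e) + x * Δ w (suc e)) (begin
  + (n ∸ r) - + e                 ≡⟨ shift (+ (n ∸ r)) (+ e) ⟩
  + suc (n ∸ r) - + suc e         ≡⟨ cong (λ m → + m - + suc e) (ℕP.+-∸-assoc 1 r≤n) ⟨
  + (suc n ∸ r) - + suc e         ∎)
  where
  open ≡-Reasoning
  shift : ∀ a b → a - b ≡ (+ 1 + a) - (+ 1 + b)
  shift = solve-∀

insertWeight-Δ : (n r : ℕ) (w : ℕ → ℤ) → r ≤ suc n → Δ (insertWeight (suc n) r w) ≗ insertWeight n r (Δ w)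
insertWeight-Δ n r w r≤1+n e rewrite ℕP.+-∸-assoc 1 r≤1+n =
  commute (+ n) (+ (suc n ∸ r)) (+ e) (w e) (w (suc e)) (w (suc (suc e)))
  where
  commute : ∀ n d e w₀ w₁ w₂ →
    (+ 1 + (+ 1 + n)) * w₁ + ((+ 1 + d) - (+ 1 + e)) * (w₂ - w₁)
      - ((+ 1 + (+ 1 + n)) * w₀ + ((+ 1 + d) - e) * (w₁ - w₀))
      ≡ (+ 1 + n) * (w₁ - w₀) + (d - e) * ((w₂ - w₁) - (w₁ - w₀))
  commute = solve-∀

excSum-shift-top : (n : ℕ) (w : ℕ → ℤ) →
  excSum (2 ℕ.+ n) (suc n) (w ∘ suc) ≡ excSum (suc n) (suc n) w + + suc n * excSum (suc n) n (Δ w)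
excSum-shift-top n w = begin
  excSum (2 ℕ.+ n) (suc n) (w ∘ suc)
    ≡⟨ excSum-suc (2 ℕ.+ n) n (w ∘ suc) ⟩
  excSum (2 ℕ.+ n) n (insertWeight n (2 ℕ.+ n) (w ∘ suc))
    ≡⟨ excSum-≥ (2 ℕ.+ n) n (insertWeight n (2 ℕ.+ n) (w ∘ suc)) (ℕP.m≤n+m n 2) ⟩
  + L * insertWeight n (2 ℕ.+ n) (w ∘ suc) 0
    ≡⟨ cong (+ L *_) (insertWeight-≥ n (2 ℕ.+ n) (w ∘ suc) (ℕP.n≤1+n (suc n))) ⟩
  + L * (+ suc n * w 1)
    ≡⟨ split (+ L) (+ suc n) (w 0) (w 1) ⟩
  + L * (+ suc n * w 0) + + suc n * (+ L * Δ w 0)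
    ≡⟨ cong₂ (λ x y → + L * x + + suc n * y)
             (insertWeight-≥ n (suc n) w ℕP.≤-refl) (excSum-≥ (suc n) n (Δ w) (ℕP.n≤1+n n)) ⟨
  + L * insertWeight n (suc n) w 0 + + suc n * excSum (suc n) n (Δ w)
    ≡⟨ cong (_+ + suc n * excSum (suc n) n (Δ w)) (excSum-≥ (suc n) n (insertWeight n (suc n) w) (ℕP.n≤1+n n)) ⟨
  excSum (suc n) n (insertWeight n (suc n) w) + + suc n * excSum (suc n) n (Δ w)
    ≡⟨ cong (_+ + suc n * excSum (suc n) n (Δ w)) (excSum-suc (suc n) n w) ⟨
  excSum (suc n) (suc n) w + + suc n * excSum (suc n) n (Δ w) ∎
  where
  open ≡-Reasoning
  L = length (perms n)
  split : ∀ l r w₀ w₁ → l * (r * w₁) ≡ l * (r * w₀) + r * (l * (w₁ - w₀))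
  split = solve-∀

excSum-shift : (r n : ℕ) (w : ℕ → ℤ) → r ≤ suc n →
               excSum (suc r) (suc n) (w ∘ suc) ≡ excSum r (suc n) w + + r * excSum r n (Δ w)
excSum-shift r n w r≤1+n with ℕP.m≤n⇒m<n∨m≡n r≤1+n
excSum-shift .(suc n) n w _ | inj₂ refl = excSum-shift-top n w
-- S₁ contains only the identity, so both sides evaluate to w 1 + + 0.
excSum-shift r zero w _ | inj₁ (s≤s z≤n) = sym (ℤP.+-identityʳ _)
excSum-shift r (suc m) w _ | inj₁ (s≤s r≤1+m) = begin
  excSum (suc r) (2 ℕ.+ m) (w ∘ suc)
    ≡⟨ excSum-suc (suc r) (suc m) (w ∘ suc) ⟩
  excSum (suc r) (suc m) (insertWeight (suc m) (suc r) (w ∘ suc))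
    ≡⟨ excSum-cong (suc r) (suc m) (insertWeight-shift (suc m) r w r≤1+m) ⟩
  excSum (suc r) (suc m) (insertWeight (suc m) r w ∘ suc)
    ≡⟨ excSum-shift r m (insertWeight (suc m) r w) r≤1+m ⟩
  excSum r (suc m) (insertWeight (suc m) r w) + + r * excSum r m (Δ (insertWeight (suc m) r w))
    ≡⟨ cong₂ (λ x y → x + + r * y) (sym (excSum-suc r (suc m) w)) (excSum-cong r m (insertWeight-Δ m r w r≤1+m)) ⟩
  excSum r (2 ℕ.+ m) w + + r * excSum r m (insertWeight m r (Δ w))
    ≡⟨ cong (λ y → excSum r (2 ℕ.+ m) w + + r * y) (excSum-suc r m (Δ w)) ⟨
  excSum r (2 ℕ.+ m) w + + r * excSum r (suc m) (Δ w) ∎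
  where open ≡-Reasoning

mainTheorem12 : (n r : ℕ) → 1 ≤ n → r ≤ n → (t : ℤ) →
    t * A (suc r) n t ≡ A r n t + (+ r) * (t - + 1) * A r (n ∸ 1) t
mainTheorem12 (suc n) r _ r≤1+n t = begin
  t * A (suc r) (suc n) t
    ≡⟨ excSum-*ˡ (suc r) (suc n) t (t ^_) ⟨
  excSum (suc r) (suc n) ((t ^_) ∘ suc)
    ≡⟨ excSum-shift r n (t ^_) r≤1+n ⟩
  A r (suc n) t + + r * excSum r n (Δ (t ^_))
    ≡⟨ cong (λ x → A r (suc n) t + + r * x) (trans (excSum-cong r n Δ-power) (excSum-*ˡ r n (t - + 1) (t ^_))) ⟩
  A r (suc n) t + + r * ((t - + 1) * A r n t)
    ≡⟨ cong (_+_ (A r (suc n) t)) (ℤP.*-assoc (+ r) (t - + 1) (A r n t)) ⟨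
  A r (suc n) t + + r * (t - + 1) * A r n t ∎
  where
  open ≡-Reasoning
  Δ-power : Δ (t ^_) ≗ λ e → (t - + 1) * t ^ e
  Δ-power e = factor t (t ^ e)
    where
    factor : ∀ t x → t * x - x ≡ (t - + 1) * x
    factor = solve-∀
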